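{- Let $m\ge 1$, $t,\lambda\ge 1$ be integers, and let $\mathbf{v}=(v_1,\ldots,v_m)$ and $\mathbf{k}=(k_1,\ldots,k_m)$ be $m$-tuples of positive integers with $\mathbf{v}\ge\mathbf{k}$ componentwise and $\sum_i k_i\ge t$. Then $$D_\lambda(\mathbf{v},\mathbf{k},t)\le \min_{i:\,k_i\ge t} D_\lambda(v_i,k_i,t).$$
   Context: Let $X_1,\ldots,X_m$ be pairwise disjoint sets with $|X_i|=v_i$. A block is an $m$-tuple $(B_1,\ldots,B_m)$ with $B_i\subseteq X_i$ and $|B_i|=k_i$. An $m$-tuple $(T_1,\ldots,T_m)$ is admissible if $T_i\subseteq X_i$, $|T_i|\le k_i$ for all $i$, and $\sum_i|T_i|=t$ (some $T_i$ may be empty); it is contained in a block $(B_1,\ldots,B_m)$ if $T_i\subseteq B_i$ for all $i$. A $t$-$(\mathbf{v},\mathbf{k},\lambda)$ generalized packing is a family of blocks such that every admissible $m$-tuple is contained in at most $\lambda$ blocks of the family. $D_\lambda(\mathbf{v},\mathbf{k},t)$ denotes the maximum number of blocks in such a generalized packing. For integers $v\ge k\ge t$, the ordinary packing number $D_\lambda(v,k,t)$ is the maximum number of $k$-subsets (blocks) of a $v$-set such that every $t$-subset lies in at most $\lambda$ blocks. -}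

module Defs where

open import Data.Nat using (ℕ; zero; suc; _+_; _≤_)
open import Data.Fin using (Fin) renaming (zero to fzero; suc to fsuc)
import Data.Fin.Properties as FinP
open import Data.Fin.Subset using (Subset; _⊆_; ∣_∣)
open import Data.Fin.Subset.Properties using (_⊆?_)
open import Data.List using (List; length; filter)
open import Data.Product using (Σ; proj₁; _×_)
open import Relation.Binary.PropositionalEquality using (_≡_)

∑ : {m : ℕ} → (Fin m → ℕ) → ℕ
∑ {zero}  f = 0
∑ {suc m} f = f fzero + ∑ (λ i → f (fsuc i))

-- Ordinary packings.  The v-set is Fin v, a block is a k-subset;
-- a packing is a family (list, repetitions allowed) of blocks.

Block : (v k : ℕ) → Set
Block v k = Σ (Subset v) (λ B → ∣ B ∣ ≡ k)

countContaining : {v k : ℕ} → Subset v → List (Block v k) → ℕ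
countContaining T P = length (filter (λ B → T ⊆? proj₁ B) P)

IsPacking : (lam v k t : ℕ) → List (Block v k) → Set
IsPacking lam v k t P =
  (T : Subset v) → ∣ T ∣ ≡ t → countContaining T P ≤ lam

IsPackingNumber : (lam v k t n : ℕ) → Set
IsPackingNumber lam v k t n =
  Σ (List (Block v k)) (λ P → IsPacking lam v k t P × length P ≡ n)
  × ((P : List (Block v k)) → IsPacking lam v k t P → length P ≤ n)

-- Generalized packings.  X_i = Fin (v i), pairwise disjoint by
-- construction (indexed by i).

GBlock : {m : ℕ} → (v k : Fin m → ℕ) → Set
GBlock {m} v k = Σ ((i : Fin m) → Subset (v i)) (λ B → (i : Fin m) → ∣ B i ∣ ≡ k i)

Admissible : {m : ℕ} → (v k : Fin m → ℕ) → (t : ℕ) → ((i : Fin m) → Subset (v i)) → Set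
Admissible v k t T = ((i : _) → ∣ T i ∣ ≤ k i) × (∑ (λ i → ∣ T i ∣) ≡ t)

gCountContaining : {m : ℕ} {v k : Fin m → ℕ} → ((i : Fin m) → Subset (v i)) → List (GBlock v k) → ℕ
gCountContaining T P = length (filter (λ B → FinP.all? (λ i → T i ⊆? proj₁ B i)) P)

IsGenPacking : {m : ℕ} → (lam : ℕ) → (v k : Fin m → ℕ) → (t : ℕ) → List (GBlock v k) → Set
IsGenPacking {m} lam v k t P =
  (T : (i : Fin m) → Subset (v i)) → Admissible v k t T → gCountContaining T P ≤ lam

IsGenPackingNumber : {m : ℕ} → (lam : ℕ) → (v k : Fin m → ℕ) → (t n : ℕ) → Set
IsGenPackingNumber lam v k t n =
  Σ (List (GBlock v k)) (λ P → IsGenPacking lam v k t P × length P ≡ n)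
  × ((P : List (GBlock v k)) → IsGenPacking lam v k t P → length P ≤ n)

module Submission where

-- Projecting every block (B_1,…,B_m) of a generalized packing onto its
-- i-th coordinate B_i yields a family of k_i-subsets of X_i of the same size.
-- It is an ordinary t-(v_i,k_i,λ) packing: a t-subset T ⊆ X_i lies in B_i
-- exactly when the m-tuple  single i T  (T in coordinate i, ∅ elsewhere) is
-- contained in (B_1,…,B_m), and this m-tuple is admissible because
-- |T| = t ≤ k_i and its sizes sum to t.  Hence the projected family has at most
-- D_λ(v_i,k_i,t) blocks, and so does the original generalized packing.

open import Defs
open import Data.Nat using (ℕ; _≤_; zero; suc; _+_; z≤n)
open import Data.Nat.Properties using (+-identityʳ)
open import Data.Fin using (Fin; _≟_) renaming (zero to fzero; suc to fsuc)
open import Data.Fin.Properties using (suc-injective; all?)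
open import Data.Fin.Subset using (Subset; _⊆_; ∣_∣; ⊥)
open import Data.Fin.Subset.Properties using (_⊆?_; ∣⊥∣≡0; ⊆-min)
open import Data.List using (List; []; _∷_; length; filter; map)
open import Data.List.Properties using (length-map; filter-≐)
open import Data.Product using (proj₁; proj₂; _,_)
open import Function using (_∘_)
open import Relation.Binary.PropositionalEquality
  using (_≡_; _≢_; refl; sym; trans; cong; subst; module ≡-Reasoning)
open import Relation.Nullary using (yes; no; does)
open import Relation.Unary using (Pred; Decidable; _≐_)
open import Data.Empty using (⊥-elim)
open import Data.Bool using (true; false)

∑-zero : {m : ℕ} (f : Fin m → ℕ) → (∀ j → f j ≡ 0) → ∑ f ≡ 0
∑-zero {zero}  f f≡0 = refl
∑-zero {suc m} f f≡0 rewrite f≡0 fzero = ∑-zero (f ∘ fsuc) (f≡0 ∘ fsuc)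

∑-supported : {m : ℕ} (f : Fin m → ℕ) (i : Fin m) →
  (∀ j → i ≢ j → f j ≡ 0) → ∑ f ≡ f i
∑-supported {suc m} f fzero f≡0 = begin
  f fzero + ∑ (f ∘ fsuc) ≡⟨ cong (f fzero +_) (∑-zero (f ∘ fsuc) (λ j → f≡0 (fsuc j) (λ ()))) ⟩
  f fzero + 0            ≡⟨ +-identityʳ (f fzero) ⟩
  f fzero                ∎
  where open ≡-Reasoning
∑-supported {suc m} f (fsuc i) f≡0 rewrite f≡0 fzero (λ ()) =
  ∑-supported (f ∘ fsuc) i (λ j i≢j → f≡0 (fsuc j) (i≢j ∘ suc-injective))

filter-map : ∀ {a b p} {A : Set a} {B : Set b} {P : Pred B p}
  (P? : Decidable P) (f : A → B) (xs : List A) →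
  filter P? (map f xs) ≡ map f (filter (P? ∘ f) xs)
filter-map P? f []       = refl
filter-map P? f (x ∷ xs) with does (P? (f x))
... | true  = cong (f x ∷_) (filter-map P? f xs)
... | false = filter-map P? f xs

length-filter-map : ∀ {a b p q} {A : Set a} {B : Set b} {P : Pred B p} {Q : Pred A q}
  (P? : Decidable P) (Q? : Decidable Q) (f : A → B) → (P ∘ f) ≐ Q →
  (xs : List A) → length (filter P? (map f xs)) ≡ length (filter Q? xs)
length-filter-map P? Q? f P∘f≐Q xs = begin
  length (filter P? (map f xs))       ≡⟨ cong length (filter-map P? f xs) ⟩
  length (map f (filter (P? ∘ f) xs)) ≡⟨ length-map f (filter (P? ∘ f) xs) ⟩
  length (filter (P? ∘ f) xs)         ≡⟨ cong length (filter-≐ (P? ∘ f) Q? P∘f≐Q xs) ⟩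
  length (filter Q? xs)               ∎
  where open ≡-Reasoning

module _ {m : ℕ} (v : Fin m → ℕ) (i : Fin m) (T : Subset (v i)) where

  single : (j : Fin m) → Subset (v j)
  single j with i ≟ j
  ... | yes refl = T
  ... | no  _    = ⊥

  single-at : single i ≡ T
  single-at with i ≟ i
  ... | yes refl = refl
  ... | no  i≢i  = ⊥-elim (i≢i refl)

  single-off : ∀ j → i ≢ j → single j ≡ ⊥
  single-off j i≢j with i ≟ j
  ... | yes i≡j = ⊥-elim (i≢j i≡j)
  ... | no  _   = refl

  single-⊆ : (B : (j : Fin m) → Subset (v j)) → T ⊆ B i → ∀ j → single j ⊆ B j
  single-⊆ B T⊆Bi j with i ≟ j
  ... | yes refl = T⊆Bi
  ... | no  _    = ⊆-min (B j)

  ⊆-single : (B : (j : Fin m) → Subset (v j)) → (∀ j → single j ⊆ B j) → T ⊆ B i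
  ⊆-single B single⊆B = subst (_⊆ B i) single-at (single⊆B i)

  ∑-∣single∣ : ∑ (λ j → ∣ single j ∣) ≡ ∣ T ∣
  ∑-∣single∣ = trans
    (∑-supported (λ j → ∣ single j ∣) i (λ j i≢j → trans (cong ∣_∣ (single-off j i≢j)) (∣⊥∣≡0 (v j))))
    (cong ∣_∣ single-at)

  single-admissible : (k : Fin m → ℕ) (t : ℕ) → ∣ T ∣ ≡ t → t ≤ k i → Admissible v k t single
  single-admissible k t ∣T∣≡t t≤ki = fits , trans ∑-∣single∣ ∣T∣≡t
    where
    fits : ∀ j → ∣ single j ∣ ≤ k j
    fits j with i ≟ j
    ... | yes refl = subst (_≤ k i) (sym ∣T∣≡t) t≤ki
    ... | no  _    = subst (_≤ k j) (sym (∣⊥∣≡0 (v j))) z≤n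

module _ {m : ℕ} {v k : Fin m → ℕ} (i : Fin m) where

  component : GBlock v k → Block (v i) (k i)
  component B = proj₁ B i , proj₂ B i

  count-component : (T : Subset (v i)) (P : List (GBlock v k)) →
    countContaining T (map component P) ≡ gCountContaining (single v i T) P
  count-component T = length-filter-map
    (λ B → T ⊆? proj₁ B)
    (λ B → all? (λ j → single v i T j ⊆? proj₁ B j))
    component
    ((λ {B} → single-⊆ v i T (proj₁ B)) , (λ {B} → ⊆-single v i T (proj₁ B)))

  component-packing : (lam t : ℕ) → t ≤ k i → (P : List (GBlock v k)) →
    IsGenPacking lam v k t P → IsPacking lam (v i) (k i) t (map component P)
  component-packing lam t t≤ki P P-packing T ∣T∣≡t =
    subst (_≤ lam) (sym (count-component T P))
      (P-packing (single v i T) (single-admissible v i T k t ∣T∣≡t t≤ki))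

proposition3p1 : (m t lam : ℕ) → 1 ≤ m → 1 ≤ t → 1 ≤ lam →
    (v k : Fin m → ℕ) → (∀ i → 1 ≤ k i) → (∀ i → 1 ≤ v i) → (∀ i → k i ≤ v i) →
    t ≤ ∑ k →
    -- D_lam(v,k,t) ≤ min over i with k_i ≥ t of D_lam(v_i,k_i,t)
    (D : ℕ) → IsGenPackingNumber lam v k t D →
    (i : Fin m) → t ≤ k i →
    (Di : ℕ) → IsPackingNumber lam (v i) (k i) t Di →
    D ≤ Di
proposition3p1 m t lam _ _ _ v k _ _ _ _ D ((P , P-packing , ∣P∣≡D) , _) i t≤ki Di (_ , Di-maximal) =
  subst (_≤ Di) same-size (Di-maximal (map (component i) P) projection-packing)
  where
  projection-packing : IsPacking lam (v i) (k i) t (map (component i) P)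
  projection-packing = component-packing i lam t t≤ki P P-packing

  same-size : length (map (component i) P) ≡ D
  same-size = trans (length-map (component i) P) ∣P∣≡D
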